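{- Let $k\ge 2$ be an even integer. Then the chordal $m$-ring graph $CMR(m,n,c)$ with $m=k/2$, $n=3k$ and $c=3$ has diameter $k$ and order $N=mn=\frac{3}{2}k^2$, which is the maximum possible order of a chordal multi-ring graph with diameter $k$.
   Context: Given positive integers $m$, $n$ (even) and $c>1$ (odd), the chordal $m$-ring graph $CMR(m,n,c)$ has vertex set $\mathbb{Z}_m\times\mathbb{Z}_n$, with edges $(\alpha,i)\sim(\alpha,i\pm1)$ for all $\alpha\in\mathbb{Z}_m$, $i\in\mathbb{Z}_n$, and $(\alpha,i)\sim(\alpha+1,i+c)$ if $i$ is even (equivalently $(\alpha,i)\sim(\alpha-1,i-c)$ if $i$ is odd). It is a 3-regular bipartite graph on $N=mn$ vertices formed by $m$ cycles of length $n$ joined by chords. The diameter is the maximum distance between two vertices. -}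

module Defs where

open import Data.Nat using (ℕ; zero; suc; _+_; _*_; _%_; _≤_)
open import Data.Nat.Divisibility using (_∣_)
open import Data.Fin using (Fin; toℕ)
open import Data.Product using (_×_; _,_)
open import Data.Sum using (_⊎_)
open import Relation.Binary.PropositionalEquality using (_≡_)

-- reduction modulo n (n = 0 never occurs for vertices, since Fin 0 is empty)
modN : ℕ → ℕ → ℕ
modN zero    x = x
modN (suc n) x = x % suc n

Vertex : ℕ → ℕ → Set
Vertex m n = Fin m × Fin n

Adj : (m n c : ℕ) → Vertex m n → Vertex m n → Set
Adj m n c (a , i) (b , j) =
  (a ≡ b × (toℕ j ≡ modN n (toℕ i + 1) ⊎ toℕ i ≡ modN n (toℕ j + 1)))
  ⊎ (2 ∣ toℕ i × toℕ b ≡ modN m (toℕ a + 1) × toℕ j ≡ modN n (toℕ i + c))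
  ⊎ (2 ∣ toℕ j × toℕ a ≡ modN m (toℕ b + 1) × toℕ i ≡ modN n (toℕ j + c))

data Within (m n c : ℕ) : ℕ → Vertex m n → Vertex m n → Set where
  here : ∀ {d u} → Within m n c d u u
  step : ∀ {d u w v} → Adj m n c u w → Within m n c d w v → Within m n c (suc d) u v

HasDiameter : (m n c k : ℕ) → Set
HasDiameter m n c k =
  (∀ u v → Within m n c k u v)
  × (∀ d → (∀ u v → Within m n c d u v) → k ≤ d)

module Submission where

-- Encode a walk from a vertex u by a point (x, y, z) of ℤ³: a step out of a vertex of
-- u's colour adds a unit vector (e₀ up the cycle, e₁ down, e₂ along the chord), a step
-- out of a vertex of the other colour subtracts one.  The endpoint is u shifted by
-- ±(z, x − y + c·z) modulo (m, n), the coordinate sum records the change of colour,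
-- and after d steps the point lies in the hexagon |x − y − z|, |y − x − z|, |z − x − y| ≤ d.
--
-- If every vertex is within 2r of u, each vertex of the other colour is hit by one of
-- the 3r² points of coordinate sum 1 in the hexagon of radius 2r, so mn/2 ≤ 3r².
-- In CMR(r, 6r, 3) these 3r² points are reached by walks of length ≤ 2r − 1 and land on
-- distinct vertices (the only short lattice vector with zero offset modulo (r, 6r) is 0),
-- so they exhaust the other colour, and the same colour is one step further.  The vertex
-- (0, 2r) needs 2r steps from (0, 0): a shorter walk would give a second short lattice
-- point over it besides the one of 2r steps up the cycle.

open import Defs
open import Data.Nat as ℕ using (ℕ; zero; suc; z≤n; s≤s; _≤_; _<_; _%_; _/_; NonZero; parity)
import Data.Nat.Properties as ℕₚ
open import Data.Nat.DivMod
  using (m≡m%n+[m/n]*n; m%n<n; [m+kn]%n≡m%n; m<n⇒m%n≡m; %-distribˡ-+; m%n%n≡m%n; m<n*o⇒m/o<n; m*n/n≡m)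
open import Data.Nat.Divisibility using (_∣_; divides; quotient; m∣n⇒n≡quotient*m; ∣⇒≤; ∣n⇒∣m*n)
open import Data.Nat.Tactic.RingSolver using () renaming (solve-∀ to solve-ℕ)
open import Data.Integer as ℤ using (ℤ; +_; -[1+_]; ∣_∣)
import Data.Integer.Properties as ℤₚ
import Data.Integer.Divisibility.Signed as ℤ∣
open import Data.Integer.Tactic.RingSolver using (solve-∀)
open import Data.Parity as ℙ using (Parity; 0ℙ; 1ℙ)
import Data.Parity.Properties as ℙₚ
open import Data.Fin as Fin using (Fin; toℕ; fromℕ<)
import Data.Fin.Properties as Finₚ
open import Data.Fin.Patterns using (0F; 1F; 2F)
open import Data.Product using (Σ; ∃; _×_; _,_; proj₁; proj₂; uncurry)
open import Data.Product.Properties using (,-injectiveˡ; ,-injectiveʳ)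
open import Data.Sum using (_⊎_; inj₁; inj₂)
open import Data.Empty using (⊥-elim)
open import Function using (_∘_)
open import Function.Definitions using (Injective)
open import Relation.Nullary using (¬_; yes; no; contradiction)
open import Relation.Binary.PropositionalEquality

module _ {m n c : ℕ} where

  within-snoc : ∀ {d u w v} → Within m n c d u w → Adj m n c w v → Within m n c (suc d) u v
  within-snoc here         e = step e here
  within-snoc (step e′ ws) e = step e′ (within-snoc ws e)

  within-weaken : ∀ {d d′ u v} → d ≤ d′ → Within m n c d u v → Within m n c d′ u v
  within-weaken _          here        = here
  within-weaken (s≤s d≤d′) (step e ws) = step e (within-weaken d≤d′ ws)

bit : Parity → ℕ
bit 0ℙ = 0
bit 1ℙ = 1

parity≡0ℙ⇒2∣ : ∀ n → parity n ≡ 0ℙ → 2 ∣ n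
parity≡0ℙ⇒2∣ zero          _ = divides 0 refl
parity≡0ℙ⇒2∣ (suc (suc n)) p with divides q n≡q*2 ← parity≡0ℙ⇒2∣ n p =
  divides (suc q) (cong (suc ∘ suc) n≡q*2)

2∣⇒parity≡0ℙ : ∀ {n} → 2 ∣ n → parity n ≡ 0ℙ
2∣⇒parity≡0ℙ (divides q refl) = trans (ℙₚ.*-homo-* q 2) (ℙₚ.*-zeroʳ (parity q))

∤2⇒parity≡1ℙ : ∀ {n} → ¬ 2 ∣ n → parity n ≡ 1ℙ
∤2⇒parity≡1ℙ {n} 2∤n with parity n in eq
... | 0ℙ = contradiction (parity≡0ℙ⇒2∣ n eq) 2∤n
... | 1ℙ = refl

parity-% : ∀ m n .{{_ : NonZero n}} → 2 ∣ n → parity (m % n) ≡ parity m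
parity-% m n 2∣n = begin
  parity (m % n)                              ≡⟨ ℙₚ.+-identityʳ _ ⟨
  parity (m % n) ℙ.+ 0ℙ                       ≡⟨ cong (parity (m % n) ℙ.+_) (2∣⇒parity≡0ℙ (∣n⇒∣m*n (m / n) 2∣n)) ⟨
  parity (m % n) ℙ.+ parity (m / n ℕ.* n)     ≡⟨ ℙₚ.+-homo-+ (m % n) _ ⟨
  parity (m % n ℕ.+ m / n ℕ.* n)              ≡⟨ cong parity (m≡m%n+[m/n]*n m n) ⟨
  parity m                                    ∎
  where open ≡-Reasoning

m%2≡bit[parity] : ∀ m → m % 2 ≡ bit (parity m)
m%2≡bit[parity] zero          = refl
m%2≡bit[parity] (suc zero)    = refl
m%2≡bit[parity] (suc (suc m)) = m%2≡bit[parity] m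

half-injective : ∀ {m n} → parity m ≡ parity n → m / 2 ≡ n / 2 → m ≡ n
half-injective {m} {n} same-parity same-half = begin
  m                      ≡⟨ m≡m%n+[m/n]*n m 2 ⟩
  m % 2 ℕ.+ m / 2 ℕ.* 2  ≡⟨ cong₂ (λ r q → r ℕ.+ q ℕ.* 2) same-rem same-half ⟩
  n % 2 ℕ.+ n / 2 ℕ.* 2  ≡⟨ m≡m%n+[m/n]*n n 2 ⟨
  n                      ∎
  where
  open ≡-Reasoning
  same-rem : m % 2 ≡ n % 2
  same-rem = trans (m%2≡bit[parity] m) (trans (cong bit same-parity) (sym (m%2≡bit[parity] n)))

m+m≡m*2 : ∀ m → m ℕ.+ m ≡ m ℕ.* 2
m+m≡m*2 = solve-ℕ

infixl 6 _+ᶠ_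
_+ᶠ_ : ∀ {K} → Fin (suc K) → ℕ → Fin (suc K)
_+ᶠ_ {K} i o = Fin.fromℕ< (m%n<n (toℕ i ℕ.+ o) (suc K))

toℕ-+ᶠ : ∀ {K} (i : Fin (suc K)) o → toℕ (i +ᶠ o) ≡ (toℕ i ℕ.+ o) % suc K
toℕ-+ᶠ {K} i o = Finₚ.toℕ-fromℕ< (m%n<n (toℕ i ℕ.+ o) (suc K))

+ᶠ-undo : ∀ {K} (i : Fin (suc K)) o → toℕ i ≡ (toℕ (i +ᶠ o ℕ.* K) ℕ.+ o) % suc K
+ᶠ-undo {K} i o = sym (begin
  (toℕ (i +ᶠ o ℕ.* K) ℕ.+ o) % suc K           ≡⟨ cong (λ a → (a ℕ.+ o) % suc K) (toℕ-+ᶠ i (o ℕ.* K)) ⟩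
  ((toℕ i ℕ.+ o ℕ.* K) % suc K ℕ.+ o) % suc K  ≡⟨ %-distribˡ-+ ((toℕ i ℕ.+ o ℕ.* K) % suc K) o (suc K) ⟩
  ((toℕ i ℕ.+ o ℕ.* K) % suc K % suc K ℕ.+ o % suc K) % suc K
     ≡⟨ cong (λ a → (a ℕ.+ o % suc K) % suc K) (m%n%n≡m%n (toℕ i ℕ.+ o ℕ.* K) (suc K)) ⟩
  ((toℕ i ℕ.+ o ℕ.* K) % suc K ℕ.+ o % suc K) % suc K  ≡⟨ %-distribˡ-+ (toℕ i ℕ.+ o ℕ.* K) o (suc K) ⟨
  (toℕ i ℕ.+ o ℕ.* K ℕ.+ o) % suc K            ≡⟨ cong (_% suc K) (regroup (toℕ i) o K) ⟩
  (toℕ i ℕ.+ o ℕ.* suc K) % suc K              ≡⟨ [m+kn]%n≡m%n (toℕ i) o (suc K) ⟩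
  toℕ i % suc K                                ≡⟨ m<n⇒m%n≡m (Finₚ.toℕ<n i) ⟩
  toℕ i                                        ∎)
  where
  open ≡-Reasoning
  regroup : ∀ x o K → x ℕ.+ o ℕ.* K ℕ.+ o ≡ x ℕ.+ o ℕ.* suc K
  regroup = solve-ℕ

module Congruence where
  open import Data.Integer using (_+_; _-_; _*_; -_)

  infix 4 _≡_mod_
  record _≡_mod_ (x y : ℤ) (n : ℕ) : Set where
    constructor mod-intro
    field ∣-difference : + n ℤ∣.∣ x - y
  open _≡_mod_

  private
    ∣-resp : ∀ {k x y} → k ℤ∣.∣ x → x ≡ y → k ℤ∣.∣ y
    ∣-resp k∣x refl = k∣x

    flip-difference : ∀ x y → - (x - y) ≡ y - x
    flip-difference = solve-∀

    split-difference : ∀ x y z → (x - y) + (y - z) ≡ x - z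
    split-difference = solve-∀

    sum-difference : ∀ x y x′ y′ → (x - y) + (x′ - y′) ≡ (x + x′) - (y + y′)
    sum-difference = solve-∀

  ≡⇒≡-mod : ∀ {x y n} → x ≡ y → x ≡ y mod n
  ≡⇒≡-mod {x} refl = mod-intro (ℤ∣.divides (+ 0) (ℤₚ.+-inverseʳ x))

  mod-refl : ∀ {x n} → x ≡ x mod n
  mod-refl {x} = ≡⇒≡-mod {x} refl

  mod-sym : ∀ {x y n} → x ≡ y mod n → y ≡ x mod n
  mod-sym {x} {y} (mod-intro x≡y) = mod-intro (∣-resp (ℤ∣.∣m⇒∣-m x≡y) (flip-difference x y))

  mod-trans : ∀ {x y z n} → x ≡ y mod n → y ≡ z mod n → x ≡ z mod n
  mod-trans {x} {y} {z} (mod-intro x≡y) (mod-intro y≡z) =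
    mod-intro (∣-resp (ℤ∣.∣m∣n⇒∣m+n x≡y y≡z) (split-difference x y z))

  mod-+ : ∀ {x y x′ y′ n} → x ≡ y mod n → x′ ≡ y′ mod n → x + x′ ≡ y + y′ mod n
  mod-+ {x} {y} {x′} {y′} (mod-intro x≡y) (mod-intro x′≡y′) =
    mod-intro (∣-resp (ℤ∣.∣m∣n⇒∣m+n x≡y x′≡y′) (sum-difference x y x′ y′))

  mod-∣ : ∀ {x y d n} → d ∣ n → x ≡ y mod n → x ≡ y mod d
  mod-∣ d∣n (mod-intro n∣x-y) = mod-intro (ℤ∣.∣-trans (ℤ∣.∣ᵤ⇒∣ d∣n) n∣x-y)

  %⇒≡-mod : ∀ {n} .{{_ : NonZero n}} x o {y} → y ≡ (x ℕ.+ o) % n → + y ≡ + x + + o mod n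
  %⇒≡-mod {n} x o refl = mod-intro (ℤ∣.divides (- + (s / n)) (begin
    + (s % n) - + s                        ≡⟨ cong (λ t → + (s % n) - + t) (m≡m%n+[m/n]*n s n) ⟩
    + (s % n) - (+ (s % n) + + (s / n ℕ.* n))
      ≡⟨ cong (λ t → + (s % n) - (+ (s % n) + t)) (ℤₚ.pos-* (s / n) n) ⟩
    + (s % n) - (+ (s % n) + + (s / n) * + n)  ≡⟨ cancel (+ (s % n)) (+ (s / n)) (+ n) ⟩
    - + (s / n) * + n                      ∎))
    where
    open ≡-Reasoning
    s : ℕ
    s = x ℕ.+ o
    cancel : ∀ r q n → r - (r + q * n) ≡ - q * n
    cancel = solve-∀

  %⇒≡-mod⁻ : ∀ {n} .{{_ : NonZero n}} {x} y o → x ≡ (y ℕ.+ o) % n → + y ≡ + x - + o mod n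
  %⇒≡-mod⁻ y o x≡y+o =
    mod-trans (≡⇒≡-mod (sym (add-sub (+ y) (+ o)))) (mod-+ (mod-sym (%⇒≡-mod y o x≡y+o)) (mod-refl { - + o}))
    where
    add-sub : ∀ a b → a + b - b ≡ a
    add-sub = solve-∀

  ∣∧<⇒≡0 : ∀ {x n} → + n ℤ∣.∣ x → ∣ x ∣ < n → x ≡ + 0
  ∣∧<⇒≡0 {x} {n} n∣x small with ∣ x ∣ in eq
  ... | zero  = ℤₚ.∣i∣≡0⇒i≡0 eq
  ... | suc _ = contradiction (∣⇒≤ (subst (n ∣_) eq (ℤ∣.∣⇒∣ᵤ n∣x))) (ℕₚ.<⇒≱ small)

  mod-small : ∀ {x y n} → x ≡ y mod n → ∣ x - y ∣ < n → x ≡ y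
  mod-small {x} {y} (mod-intro n∣x-y) small = ℤₚ.i-j≡0⇒i≡j x y (∣∧<⇒≡0 n∣x-y small)

  ∣m-n∣<k : ∀ {m n k} → m < k → n < k → ∣ + m - + n ∣ < k
  ∣m-n∣<k {m} {n} m<k n<k with ℕₚ.≤-total n m
  ... | inj₁ n≤m = subst (_< _) (sym (cong ∣_∣ (trans (ℤₚ.m-n≡m⊖n m n) (ℤₚ.⊖-≥ n≤m))))
                     (ℕₚ.≤-<-trans (ℕₚ.m∸n≤m m n) m<k)
  ... | inj₂ m≤n = subst (_< _) (sym (trans (cong ∣_∣ (ℤₚ.m-n≡m⊖n m n)) (ℤₚ.∣⊖∣-≤ m≤n)))
                     (ℕₚ.≤-<-trans (ℕₚ.m∸n≤m n m) n<k)

  Fin-≡-mod : ∀ {n} {i j : Fin n} → + toℕ i ≡ + toℕ j mod n → i ≡ j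
  Fin-≡-mod {i = i} {j} i≡j = Finₚ.toℕ-injective (ℤₚ.+-injective
    (mod-small i≡j (∣m-n∣<k (Finₚ.toℕ<n i) (Finₚ.toℕ<n j))))

  parity-≡-mod2 : ∀ {x y} s → + y ≡ + x + + bit s mod 2 → parity y ≡ parity x ℙ.+ s
  parity-≡-mod2 {x} {y} s (mod-intro y≡x+s) = sum≡0ℙ⇒≡ (parity y) (parity x ℙ.+ s) (begin
    parity y ℙ.+ (parity x ℙ.+ s)                     ≡⟨ cong (λ p → parity y ℙ.+ (parity x ℙ.+ p)) (parity-bit s) ⟨
    parity y ℙ.+ (parity x ℙ.+ parity (bit s))        ≡⟨ cong (parity y ℙ.+_) (ℙₚ.+-homo-+ x (bit s)) ⟨
    parity y ℙ.+ parity (x ℕ.+ bit s)                 ≡⟨ ℙₚ.+-homo-+ y (x ℕ.+ bit s) ⟨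
    parity (y ℕ.+ (x ℕ.+ bit s))                      ≡⟨ 2∣⇒parity≡0ℙ (ℤ∣.∣⇒∣ᵤ 2∣sum) ⟩
    0ℙ                                                ∎)
    where
    open ≡-Reasoning
    parity-bit : ∀ s → parity (bit s) ≡ s
    parity-bit 0ℙ = refl
    parity-bit 1ℙ = refl
    sum≡0ℙ⇒≡ : ∀ p q → p ℙ.+ q ≡ 0ℙ → p ≡ q
    sum≡0ℙ⇒≡ 0ℙ 0ℙ _ = refl
    sum≡0ℙ⇒≡ 1ℙ 1ℙ _ = refl
    as-multiple : ∀ a b → a + b ≡ (a - b) + b * + 2
    as-multiple = solve-∀
    2∣sum : + 2 ℤ∣.∣ + (y ℕ.+ (x ℕ.+ bit s))
    2∣sum = ∣-resp (ℤ∣.∣m∣n⇒∣m+n y≡x+s (ℤ∣.∣n⇒∣m*n (+ x + + bit s) (ℤ∣.∣-refl {+ 2})))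
                   (sym (as-multiple (+ y) (+ x + + bit s)))

open Congruence

injective⇒surjective : ∀ {n} (f : Fin n → Fin n) → Injective _≡_ _≡_ f → ∀ y → ∃ λ i → f i ≡ y
injective⇒surjective {suc n} f f-inj y with Finₚ.any? (λ i → f i Finₚ.≟ y)
... | yes hit = hit
... | no miss = contradiction (Finₚ.injective⇒≤ punched-injective) ℕₚ.1+n≰n
  where
  y≢f : ∀ i → y ≢ f i
  y≢f i y≡fi = miss (i , sym y≡fi)
  punched : Fin (suc n) → Fin n
  punched i = Fin.punchOut (y≢f i)
  punched-injective : Injective _≡_ _≡_ punched
  punched-injective {i} {j} eq = f-inj (Finₚ.punchOut-injective (y≢f i) (y≢f j) eq)

injections-onto : ∀ {n} {A : Set} (P : A → Set) (f : Fin n → A) (g : A → Fin n) →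
                  (∀ i → P (f i)) → Injective _≡_ _≡_ f →
                  (∀ {a b} → P a → P b → g a ≡ g b → a ≡ b) →
                  ∀ a → P a → ∃ λ i → f i ≡ a
injections-onto P f g P-f f-inj g-inj a Pa
  with i , gfi≡ga ← injective⇒surjective (g ∘ f) (λ e → f-inj (g-inj (P-f _) (P-f _) e)) (g a)
  = i , g-inj (P-f i) Pa gfi≡ga

module Lattice where
  open import Data.Integer using (_+_; _-_; _*_; -_)

  Point : Set
  Point = ℤ × ℤ × ℤ

  infixl 6 _⊕_
  _⊕_ : Point → Point → Point
  (x , y , z) ⊕ (x′ , y′ , z′) = (x + x′ , y + y′ , z + z′)

  signed : Parity → ℤ → ℤ
  signed 0ℙ x = x
  signed 1ℙ x = - x

  signedᴾ : Parity → Point → Point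
  signedᴾ s (x , y , z) = (signed s x , signed s y , signed s z)

  signed-+ : ∀ g x y → signed g (x + y) ≡ signed g x + signed g y
  signed-+ 0ℙ x y = refl
  signed-+ 1ℙ x y = ℤₚ.neg-distrib-+ x y

  signed-signed : ∀ g s x → signed g (signed s x) ≡ signed (g ℙ.+ s) x
  signed-signed 0ℙ s  x = refl
  signed-signed 1ℙ 0ℙ x = refl
  signed-signed 1ℙ 1ℙ x = ℤₚ.neg-involutive x

  signed-0 : ∀ g → signed g (+ 0) ≡ + 0
  signed-0 0ℙ = refl
  signed-0 1ℙ = refl

  signed-shift : ∀ (S : Point → ℤ) → (∀ p q → S (p ⊕ q) ≡ S p + S q) →
                 (∀ s q → S (signedᴾ s q) ≡ signed s (S q)) →
                 ∀ g s p q → signed g (S (p ⊕ signedᴾ s q)) ≡ signed g (S p) + signed (g ℙ.+ s) (S q)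
  signed-shift S S-⊕ S-signed g s p q = begin
    signed g (S (p ⊕ signedᴾ s q))                ≡⟨ cong (signed g) (S-⊕ p (signedᴾ s q)) ⟩
    signed g (S p + S (signedᴾ s q))              ≡⟨ cong (λ t → signed g (S p + t)) (S-signed s q) ⟩
    signed g (S p + signed s (S q))               ≡⟨ signed-+ g (S p) _ ⟩
    signed g (S p) + signed g (signed s (S q))    ≡⟨ cong (λ t → signed g (S p) + t) (signed-signed g s (S q)) ⟩
    signed g (S p) + signed (g ℙ.+ s) (S q)       ∎
    where open ≡-Reasoning

  unit : Fin 3 → Point
  unit 0F = (+ 1 , + 0 , + 0)
  unit 1F = (+ 0 , + 1 , + 0)
  unit 2F = (+ 0 , + 0 , + 1)

  total : Point → ℤ
  total (x , y , z) = x + y + z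

  InHex : ℕ → Point → Set
  InHex d (x , y , z) = ∣ x - y - z ∣ ≤ d × ∣ y - x - z ∣ ≤ d × ∣ z - x - y ∣ ≤ d

  total-step : ∀ p s j → total p ≡ + bit s → total (p ⊕ signedᴾ s (unit j)) ≡ + bit (s ℙ.⁻¹)
  total-step p s j total≡s = begin
    total (p ⊕ signedᴾ s (unit j))          ≡⟨ total-⊕ p (signedᴾ s (unit j)) ⟩
    total p + total (signedᴾ s (unit j))    ≡⟨ cong (_+ total (signedᴾ s (unit j))) total≡s ⟩
    + bit s + total (signedᴾ s (unit j))    ≡⟨ flips-bit s j ⟩
    + bit (s ℙ.⁻¹)                          ∎
    where
    open ≡-Reasoning
    total-⊕ : ∀ p q → total (p ⊕ q) ≡ total p + total q
    total-⊕ (x , y , z) (x′ , y′ , z′) = regroup x y z x′ y′ z′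
      where
      regroup : ∀ x y z x′ y′ z′ → (x + x′) + (y + y′) + (z + z′) ≡ (x + y + z) + (x′ + y′ + z′)
      regroup = solve-∀
    flips-bit : ∀ s j → + bit s + total (signedᴾ s (unit j)) ≡ + bit (s ℙ.⁻¹)
    flips-bit 0ℙ 0F = refl
    flips-bit 0ℙ 1F = refl
    flips-bit 0ℙ 2F = refl
    flips-bit 1ℙ 0F = refl
    flips-bit 1ℙ 1F = refl
    flips-bit 1ℙ 2F = refl

  private
    signed-unit-hex-length : ∀ s j → let (x′ , y′ , z′) = signedᴾ s (unit j) in
                             ∣ x′ - y′ - z′ ∣ ≡ 1 × ∣ y′ - x′ - z′ ∣ ≡ 1 × ∣ z′ - x′ - y′ ∣ ≡ 1
    signed-unit-hex-length 0ℙ 0F = refl , refl , refl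
    signed-unit-hex-length 0ℙ 1F = refl , refl , refl
    signed-unit-hex-length 0ℙ 2F = refl , refl , refl
    signed-unit-hex-length 1ℙ 0F = refl , refl , refl
    signed-unit-hex-length 1ℙ 1F = refl , refl , refl
    signed-unit-hex-length 1ℙ 2F = refl , refl , refl

  inHex-step : ∀ {d} p s j → InHex d p → InHex (suc d) (p ⊕ signedᴾ s (unit j))
  inHex-step p s j p∈hex = step-by p (signedᴾ s (unit j)) p∈hex (signed-unit-hex-length s j)
    where
    step-by : ∀ {d} p q → InHex d p → let (x′ , y′ , z′) = q in
              ∣ x′ - y′ - z′ ∣ ≡ 1 × ∣ y′ - x′ - z′ ∣ ≡ 1 × ∣ z′ - x′ - y′ ∣ ≡ 1 →
              InHex (suc d) (p ⊕ q)
    step-by {d} (x , y , z) (x′ , y′ , z′) (bx , by , bz) (ex , ey , ez) =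
      subst (λ t → ∣ t ∣ ≤ suc d) (regroup x y z x′ y′ z′) (+-unit-≤ (x - y - z) (x′ - y′ - z′) bx ex) ,
      subst (λ t → ∣ t ∣ ≤ suc d) (regroup y x z y′ x′ z′) (+-unit-≤ (y - x - z) (y′ - x′ - z′) by ey) ,
      subst (λ t → ∣ t ∣ ≤ suc d) (regroup z x y z′ x′ y′) (+-unit-≤ (z - x - y) (z′ - x′ - y′) bz ez)
      where
      +-unit-≤ : ∀ a e → ∣ a ∣ ≤ d → ∣ e ∣ ≡ 1 → ∣ a + e ∣ ≤ suc d
      +-unit-≤ a e a≤d ∣e∣≡1 = ℕₚ.≤-trans (ℤₚ.∣i+j∣≤∣i∣+∣j∣ a e)
        (subst (λ k → ∣ a ∣ ℕ.+ k ≤ suc d) (sym ∣e∣≡1) (subst (_≤ suc d) (ℕₚ.+-comm 1 ∣ a ∣) (s≤s a≤d)))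
      regroup : ∀ x y z x′ y′ z′ → (x - y - z) + (x′ - y′ - z′) ≡ (x + x′) - (y + y′) - (z + z′)
      regroup = solve-∀

  inHex-weaken : ∀ {d d′} p → d ≤ d′ → InHex d p → InHex d′ p
  inHex-weaken _ d≤d′ (bx , by , bz) = ℕₚ.≤-trans bx d≤d′ , ℕₚ.≤-trans by d≤d′ , ℕₚ.≤-trans bz d≤d′

  HexIndex : ℕ → Set
  HexIndex r = Fin 3 × Fin r × Fin r

  -- For x, y < r these are the points of coordinate sum 1 in the hexagon of radius 2r:
  -- coordinate t is positive and coordinate t + 1 is not.
  hexPoint : Fin 3 → ℕ → ℕ → Point
  hexPoint 0F x y = (+ suc x , - + y , + y - + x)
  hexPoint 1F x y = (+ y - + x , + suc x , - + y)
  hexPoint 2F x y = (- + y , + y - + x , + suc x)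

  hexAt : ∀ {r} → HexIndex r → Point
  hexAt (t , x , y) = hexPoint t (toℕ x) (toℕ y)

  private
    data Half (r : ℕ) : ℤ → Set where
      positive    : ∀ {x} → x < r → Half r (+ suc x)
      nonpositive : ∀ {y} → y < r → Half r (- + y)

    double< : ∀ {r x} → suc (x ℕ.+ x) ≤ r ℕ.+ r → x < r
    double< {r} {x} h = ℕₚ.≰⇒> (λ r≤x → ℕₚ.<⇒≱ h (ℕₚ.+-mono-≤ r≤x r≤x))

    half : ∀ r z → ∣ + 2 * z - + 1 ∣ ≤ r ℕ.+ r → Half r z
    half r (+ suc x) h = positive (double< (subst (λ t → ∣ t ∣ ≤ r ℕ.+ r) (odd (+ x)) h))
      where
      odd : ∀ x → + 2 * (+ 1 + x) - + 1 ≡ + 1 + (x + x)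
      odd = solve-∀
    half r (+ zero)  h = nonpositive {y = 0} (double< h)
    half r -[1+ y ]  h = nonpositive {y = suc y} (double< (subst (_≤ r ℕ.+ r)
      (trans (cong ∣_∣ (odd (+ suc y))) (ℤₚ.∣-i∣≡∣i∣ (+ 1 + (+ suc y + + suc y)))) h))
      where
      odd : ∀ y → + 2 * (- y) - + 1 ≡ - (+ 1 + (y + y))
      odd = solve-∀

    hex-coordinates : ∀ {d} a b c → a + b + c ≡ + 1 → InHex d (a , b , c) →
                      ∣ + 2 * a - + 1 ∣ ≤ d × ∣ + 2 * b - + 1 ∣ ≤ d × ∣ + 2 * c - + 1 ∣ ≤ d
    hex-coordinates {d} a b c total≡1 (ha , hb , hc) =
      bound a (first a b c) ha , bound b (second a b c) hb , bound c (third a b c) hc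
      where
      bound : ∀ {e} z → e ≡ + 2 * z - (a + b + c) → ∣ e ∣ ≤ d → ∣ + 2 * z - + 1 ∣ ≤ d
      bound z e≡ = subst (λ t → ∣ t ∣ ≤ d) (trans e≡ (cong (λ s → + 2 * z - s) total≡1))
      first : ∀ a b c → a - b - c ≡ + 2 * a - (a + b + c)
      first = solve-∀
      second : ∀ a b c → b - a - c ≡ + 2 * b - (a + b + c)
      second = solve-∀
      third : ∀ a b c → c - a - b ≡ + 2 * c - (a + b + c)
      third = solve-∀

    isolate-a : ∀ a b c → a + b + c ≡ + 1 → a ≡ + 1 - b - c
    isolate-a a b c total≡1 = trans (isolate a b c) (cong (λ s → s - b - c) total≡1)
      where
      isolate : ∀ a b c → a ≡ a + b + c - b - c
      isolate = solve-∀

    isolate-b : ∀ a b c → a + b + c ≡ + 1 → b ≡ + 1 - c - a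
    isolate-b a b c total≡1 = trans (isolate a b c) (cong (λ s → s - c - a) total≡1)
      where
      isolate : ∀ a b c → b ≡ a + b + c - c - a
      isolate = solve-∀

    isolate-c : ∀ a b c → a + b + c ≡ + 1 → c ≡ + 1 - a - b
    isolate-c a b c total≡1 = trans (isolate a b c) (cong (λ s → s - a - b) total≡1)
      where
      isolate : ∀ a b c → c ≡ a + b + c - a - b
      isolate = solve-∀

    remaining : ∀ X Y → + 1 - (+ 1 + X) - (- Y) ≡ Y - X
    remaining = solve-∀

    classify : ∀ r a b c → a + b + c ≡ + 1 → InHex (r ℕ.+ r) (a , b , c) →
               ∃ λ t → ∃ λ x → ∃ λ y → x < r × y < r × (a , b , c) ≡ hexPoint t x y
    classify r a b c total≡1 in-hex with hex-coordinates a b c total≡1 in-hex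
    ... | ha , hb , hc with half r a ha | half r b hb | half r c hc
    ... | positive {x} x<r | nonpositive {y} y<r | _ =
      0F , _ , _ , x<r , y<r , cong (λ c → (a , b , c)) (trans (isolate-c a b c total≡1) (remaining (+ x) (+ y)))
    ... | _ | positive {x} x<r | nonpositive {y} y<r =
      1F , _ , _ , x<r , y<r , cong (λ a → (a , b , c)) (trans (isolate-a a b c total≡1) (remaining (+ x) (+ y)))
    ... | nonpositive {y} y<r | _ | positive {x} x<r =
      2F , _ , _ , x<r , y<r , cong (λ b → (a , b , c)) (trans (isolate-b a b c total≡1) (remaining (+ x) (+ y)))
    ... | positive {x} _ | positive {y} _ | positive {z} _ =
      contradiction (ℕₚ.suc-injective (ℤₚ.+-injective total≡1)) (ℕₚ.m+1+n≢0 (x ℕ.+ suc y))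
    ... | nonpositive {x} _ | nonpositive {y} _ | nonpositive {z} _ =
      ⊥-elim (nonpositive≢1 (trans (sym (negate (+ x) (+ y) (+ z))) total≡1))
      where
      negate : ∀ x y z → - x + - y + - z ≡ - (x + y + z)
      negate = solve-∀
      nonpositive≢1 : ∀ {n} → - + n ≢ + 1
      nonpositive≢1 {zero} ()
      nonpositive≢1 {suc n} ()

  hex-classification : ∀ r p → total p ≡ + 1 → InHex (r ℕ.+ r) p → Σ (HexIndex r) λ h → p ≡ hexAt h
  hex-classification r (a , b , c) total≡1 in-hex with classify r a b c total≡1 in-hex
  ... | t , x , y , x<r , y<r , p≡ = (t , fromℕ< x<r , fromℕ< y<r) ,
    trans p≡ (cong₂ (hexPoint t) (sym (Finₚ.toℕ-fromℕ< x<r)) (sym (Finₚ.toℕ-fromℕ< y<r)))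

  private
    coord₀ : ∀ {p q : Point} → p ≡ q → proj₁ p ≡ proj₁ q
    coord₀ = ,-injectiveˡ
    coord₁ : ∀ {p q : Point} → p ≡ q → proj₁ (proj₂ p) ≡ proj₁ (proj₂ q)
    coord₁ = ,-injectiveˡ ∘ ,-injectiveʳ
    coord₂ : ∀ {p q : Point} → p ≡ q → proj₂ (proj₂ p) ≡ proj₂ (proj₂ q)
    coord₂ = ,-injectiveʳ ∘ ,-injectiveʳ

    positive≢nonpositive : ∀ {x y} → + suc x ≢ - + y
    positive≢nonpositive {y = zero}  ()
    positive≢nonpositive {y = suc _} ()

    positive-injective : ∀ {x x′} → + suc x ≡ + suc x′ → x ≡ x′
    positive-injective = ℕₚ.suc-injective ∘ ℤₚ.+-injective

    nonpositive-injective : ∀ {y y′} → - + y ≡ - + y′ → y ≡ y′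
    nonpositive-injective = ℤₚ.+-injective ∘ ℤₚ.neg-injective

  hexPoint-injective : ∀ t x y t′ x′ y′ → hexPoint t x y ≡ hexPoint t′ x′ y′ →
                       t ≡ t′ × x ≡ x′ × y ≡ y′
  hexPoint-injective 0F _ _ 0F _ _ e = refl , positive-injective (coord₀ e) , nonpositive-injective (coord₁ e)
  hexPoint-injective 1F _ _ 1F _ _ e = refl , positive-injective (coord₁ e) , nonpositive-injective (coord₂ e)
  hexPoint-injective 2F _ _ 2F _ _ e = refl , positive-injective (coord₂ e) , nonpositive-injective (coord₀ e)
  hexPoint-injective 0F _ _ 1F _ _ e = ⊥-elim (positive≢nonpositive (sym (coord₁ e)))
  hexPoint-injective 0F _ _ 2F _ _ e = ⊥-elim (positive≢nonpositive (coord₀ e))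
  hexPoint-injective 1F _ _ 0F _ _ e = ⊥-elim (positive≢nonpositive (coord₁ e))
  hexPoint-injective 1F _ _ 2F _ _ e = ⊥-elim (positive≢nonpositive (sym (coord₂ e)))
  hexPoint-injective 2F _ _ 0F _ _ e = ⊥-elim (positive≢nonpositive (sym (coord₀ e)))
  hexPoint-injective 2F _ _ 1F _ _ e = ⊥-elim (positive≢nonpositive (coord₂ e))

  hexAt-injective : ∀ {r} → Injective _≡_ _≡_ (hexAt {r})
  hexAt-injective {x = t , x , y} {t′ , x′ , y′} e
    with refl , x≡x′ , y≡y′ ← hexPoint-injective t (toℕ x) (toℕ y) t′ (toℕ x′) (toℕ y′) e
    = cong₂ (λ x y → t , x , y) (Finₚ.toℕ-injective x≡x′) (Finₚ.toℕ-injective y≡y′)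

  encodeHex : ∀ {r} → HexIndex r → Fin (3 ℕ.* (r ℕ.* r))
  encodeHex (t , x , y) = Fin.combine t (Fin.combine x y)

  encodeHex-injective : ∀ {r} → Injective _≡_ _≡_ (encodeHex {r})
  encodeHex-injective {x = t , x , y} {t′ , x′ , y′} e
    with refl , e′ ← Finₚ.combine-injective t _ t′ _ e
    with refl , refl ← Finₚ.combine-injective x y x′ y′ e′ = refl

  decodeHex : ∀ {r} → Fin (3 ℕ.* (r ℕ.* r)) → HexIndex r
  decodeHex {r} i = let (t , xy) = Fin.remQuot (r ℕ.* r) i in t , Fin.remQuot r xy

  decodeHex-injective : ∀ {r} → Injective _≡_ _≡_ (decodeHex {r})
  decodeHex-injective {r} {i} {j} e = begin
    i                        ≡⟨ encode-decode i ⟨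
    encodeHex (decodeHex {r} i)  ≡⟨ cong encodeHex e ⟩
    encodeHex (decodeHex {r} j)  ≡⟨ encode-decode j ⟩
    j                        ∎
    where
    open ≡-Reasoning
    encode-decode : ∀ i → encodeHex (decodeHex {r} i) ≡ i
    encode-decode i = let (t , xy) = Fin.remQuot {3} (r ℕ.* r) i in
      trans (cong (Fin.combine t) (Finₚ.combine-remQuot {r} r xy)) (Finₚ.combine-remQuot {3} (r ℕ.* r) i)

  rotate : Point → Point
  rotate (a , b , c) = (c , a , b)

  next : Fin 3 → Fin 3
  next 0F = 1F
  next 1F = 2F
  next 2F = 0F

  pairMove : Fin 3 → Fin 3 → Point → Point
  pairMove j⁻ j⁺ p = p ⊕ signedᴾ 1ℙ (unit j⁻) ⊕ signedᴾ 0ℙ (unit j⁺)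

  private
    triple : ∀ {a b c a′ b′ c′ : ℤ} → a ≡ a′ → b ≡ b′ → c ≡ c′ → (a , b , c) ≡ (a′ , b′ , c′)
    triple refl refl refl = refl

    grow-positive : ∀ X → + 1 + (+ 1 + X) ≡ + 1 + X + - + 0 + + 1
    grow-positive = solve-∀
    grow-nonpositive : ∀ Y → - (+ 1 + Y) ≡ - Y + - + 1 + + 0
    grow-nonpositive = solve-∀

  grow-both : ∀ t x y → hexPoint t (suc x) (suc y) ≡ pairMove (next t) t (hexPoint t x y)
  grow-both 0F x y = triple (grow-positive (+ x)) (grow-nonpositive (+ y)) (middle (+ x) (+ y))
    where
    middle : ∀ X Y → (+ 1 + Y) - (+ 1 + X) ≡ Y - X + - + 0 + + 0
    middle = solve-∀
  grow-both 1F x y = cong rotate (grow-both 0F x y)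
  grow-both 2F x y = cong (rotate ∘ rotate) (grow-both 0F x y)

  grow-first : ∀ t x → hexPoint t (suc x) 0 ≡ pairMove (next (next t)) t (hexPoint t x 0)
  grow-first 0F x = triple (grow-positive (+ x)) refl (middle (+ x))
    where
    middle : ∀ X → + 0 - (+ 1 + X) ≡ + 0 - X + - + 1 + + 0
    middle = solve-∀
  grow-first 1F x = cong rotate (grow-first 0F x)
  grow-first 2F x = cong (rotate ∘ rotate) (grow-first 0F x)

  grow-second : ∀ t y → hexPoint t 0 (suc y) ≡ pairMove (next t) (next (next t)) (hexPoint t 0 y)
  grow-second 0F y = triple refl (grow-nonpositive (+ y)) (middle (+ y))
    where
    middle : ∀ Y → + 1 + Y - + 0 ≡ Y - + 0 + - + 0 + + 1
    middle = solve-∀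
  grow-second 1F y = cong rotate (grow-second 0F y)
  grow-second 2F y = cong (rotate ∘ rotate) (grow-second 0F y)

  hexPoint-total : ∀ t x y → total (hexPoint t x y) ≡ + 1
  hexPoint-total 0F x y = sums (+ x) (+ y)
    where
    sums : ∀ X Y → + 1 + X + - Y + (Y - X) ≡ + 1
    sums = solve-∀
  hexPoint-total 1F x y = sums (+ x) (+ y)
    where
    sums : ∀ X Y → Y - X + (+ 1 + X) + - Y ≡ + 1
    sums = solve-∀
  hexPoint-total 2F x y = sums (+ x) (+ y)
    where
    sums : ∀ X Y → - Y + (Y - X) + (+ 1 + X) ≡ + 1
    sums = solve-∀

  hexAt-total : ∀ {r} (h : HexIndex r) → total (hexAt h) ≡ + 1
  hexAt-total (t , x , y) = hexPoint-total t (toℕ x) (toℕ y)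

open Lattice

module CMR (m₀ n₀ c : ℕ) (2∣N : 2 ∣ suc n₀) (c-odd : ¬ 2 ∣ c) where
  open import Data.Integer using (_+_; _-_; _*_; -_)

  M N : ℕ
  M = suc m₀
  N = suc n₀

  V : Set
  V = Vertex M N

  infix 4 _~_
  _~_ : V → V → Set
  _~_ = Adj M N c

  ring pos : V → ℤ
  ring v = + toℕ (proj₁ v)
  pos  v = + toℕ (proj₂ v)

  parityᵛ : V → Parity
  parityᵛ v = parity (toℕ (proj₂ v))

  record Offset (v w : V) (X Y : ℤ) : Set where
    constructor offset
    field
      ring≡ : ring w ≡ ring v + X mod M
      pos≡  : pos w ≡ pos v + Y mod N

  offset-cong : ∀ {v w X Y X′ Y′} → X ≡ X′ → Y ≡ Y′ → Offset v w X Y → Offset v w X′ Y′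
  offset-cong refl refl o = o

  offset-refl : ∀ {v} → Offset v v (+ 0) (+ 0)
  offset-refl {v} = offset (≡⇒≡-mod (sym (ℤₚ.+-identityʳ (ring v)))) (≡⇒≡-mod (sym (ℤₚ.+-identityʳ (pos v))))

  offset-trans : ∀ {u v w X Y X′ Y′} → Offset u v X Y → Offset v w X′ Y′ → Offset u w (X + X′) (Y + Y′)
  offset-trans {u} {X = X} {Y} {X′} {Y′} (offset ring≡ pos≡) (offset ring≡′ pos≡′) =
    offset (chain (ring u) X X′ ring≡ ring≡′) (chain (pos u) Y Y′ pos≡ pos≡′)
    where
    chain : ∀ {b c n} a X X′ → b ≡ a + X mod n → c ≡ b + X′ mod n → c ≡ a + (X + X′) mod n
    chain a X X′ b≡a+X c≡b+X′ =
      mod-trans c≡b+X′ (mod-trans (mod-+ b≡a+X mod-refl) (≡⇒≡-mod (ℤₚ.+-assoc a X X′)))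

  offset-functional : ∀ {u v v′ X Y} → Offset u v X Y → Offset u v′ X Y → v ≡ v′
  offset-functional (offset ring≡ pos≡) (offset ring≡′ pos≡′) =
    cong₂ _,_ (Fin-≡-mod (mod-trans ring≡ (mod-sym ring≡′))) (Fin-≡-mod (mod-trans pos≡ (mod-sym pos≡′)))

  offset-difference : ∀ {u v X Y X′ Y′} → Offset u v X Y → Offset u v X′ Y′ → X ≡ X′ mod M × Y ≡ Y′ mod N
  offset-difference {u} (offset ring≡ pos≡) (offset ring≡′ pos≡′) =
    cancel (ring u) (mod-trans (mod-sym ring≡) ring≡′) , cancel (pos u) (mod-trans (mod-sym pos≡) pos≡′)
    where
    cancel : ∀ {X X′ n} a → a + X ≡ a + X′ mod n → X ≡ X′ mod n
    cancel {X} {X′} a a+X≡a+X′ =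
      mod-trans (≡⇒≡-mod (sym (drop a X))) (mod-trans (mod-+ (mod-refl { - a}) a+X≡a+X′) (≡⇒≡-mod (drop a X′)))
      where
      drop : ∀ a X → - a + (a + X) ≡ X
      drop = solve-∀

  ~-sym : ∀ {v w} → v ~ w → w ~ v
  ~-sym (inj₁ (refl , inj₁ forward))  = inj₁ (refl , inj₂ forward)
  ~-sym (inj₁ (refl , inj₂ backward)) = inj₁ (refl , inj₁ backward)
  ~-sym (inj₂ (inj₁ chord))           = inj₂ (inj₂ chord)
  ~-sym (inj₂ (inj₂ chord))           = inj₂ (inj₁ chord)

  ringUnit posUnit : Fin 3 → ℤ
  ringUnit 0F = + 0
  ringUnit 1F = + 0
  ringUnit 2F = + 1
  posUnit 0F = + 1
  posUnit 1F = - + 1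
  posUnit 2F = + c

  UnitStep : Parity → V → V → Fin 3 → Set
  UnitStep g v w j = Offset v w (signed g (ringUnit j)) (signed g (posUnit j))

  private
    stay : ∀ {α : Fin M} → + toℕ α ≡ + toℕ α + + 0 mod M
    stay {α} = ≡⇒≡-mod (sym (ℤₚ.+-identityʳ (+ toℕ α)))

    n₀-odd : parity n₀ ≡ 1ℙ
    n₀-odd = trans (sym (ℙₚ.suc-homo-⁻¹ n₀)) (cong ℙ._⁻¹ (2∣⇒parity≡0ℙ 2∣N))

    c-parity : parity c ≡ 1ℙ
    c-parity = ∤2⇒parity≡1ℙ c-odd

  up-edge : ∀ v → ∃ λ w → v ~ w × Offset v w (+ 0) (+ 1)
  up-edge (α , i) = (α , i +ᶠ 1) , inj₁ (refl , inj₁ (toℕ-+ᶠ i 1)) , offset stay (%⇒≡-mod (toℕ i) 1 (toℕ-+ᶠ i 1))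

  down-edge : ∀ v → ∃ λ w → v ~ w × Offset v w (+ 0) (- + 1)
  down-edge (α , i) = (α , i +ᶠ 1 ℕ.* n₀) , inj₁ (refl , inj₂ (+ᶠ-undo i 1)) ,
    offset stay (%⇒≡-mod⁻ (toℕ (i +ᶠ 1 ℕ.* n₀)) 1 (+ᶠ-undo i 1))

  chord-up-edge : ∀ v → parityᵛ v ≡ 0ℙ → ∃ λ w → v ~ w × Offset v w (+ 1) (+ c)
  chord-up-edge (α , i) even = (α +ᶠ 1 , i +ᶠ c) ,
    inj₂ (inj₁ (parity≡0ℙ⇒2∣ _ even , toℕ-+ᶠ α 1 , toℕ-+ᶠ i c)) ,
    offset (%⇒≡-mod (toℕ α) 1 (toℕ-+ᶠ α 1)) (%⇒≡-mod (toℕ i) c (toℕ-+ᶠ i c))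

  chord-down-edge : ∀ v → parityᵛ v ≡ 1ℙ → ∃ λ w → v ~ w × Offset v w (- + 1) (- + c)
  chord-down-edge (α , i) odd = (α +ᶠ 1 ℕ.* m₀ , i +ᶠ c ℕ.* n₀) ,
    inj₂ (inj₂ (parity≡0ℙ⇒2∣ _ target-even , +ᶠ-undo α 1 , +ᶠ-undo i c)) ,
    offset (%⇒≡-mod⁻ (toℕ (α +ᶠ 1 ℕ.* m₀)) 1 (+ᶠ-undo α 1))
           (%⇒≡-mod⁻ (toℕ (i +ᶠ c ℕ.* n₀)) c (+ᶠ-undo i c))
    where
    open ≡-Reasoning
    target-even : parity (toℕ (i +ᶠ c ℕ.* n₀)) ≡ 0ℙ
    target-even = begin
      parity (toℕ (i +ᶠ c ℕ.* n₀))                         ≡⟨ cong parity (toℕ-+ᶠ i (c ℕ.* n₀)) ⟩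
      parity ((toℕ i ℕ.+ c ℕ.* n₀) ℕ.% N)                  ≡⟨ parity-% (toℕ i ℕ.+ c ℕ.* n₀) N 2∣N ⟩
      parity (toℕ i ℕ.+ c ℕ.* n₀)                          ≡⟨ ℙₚ.+-homo-+ (toℕ i) _ ⟩
      parity (toℕ i) ℙ.+ parity (c ℕ.* n₀)                 ≡⟨ cong (parity (toℕ i) ℙ.+_) (ℙₚ.*-homo-* c n₀) ⟩
      parity (toℕ i) ℙ.+ (parity c ℙ.* parity n₀)          ≡⟨ cong₂ (λ a b → a ℙ.+ (b ℙ.* parity n₀)) odd c-parity ⟩
      1ℙ ℙ.+ (1ℙ ℙ.* parity n₀)                            ≡⟨ cong (λ b → 1ℙ ℙ.+ (1ℙ ℙ.* b)) n₀-odd ⟩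
      0ℙ                                                   ∎

  unit-edge : ∀ v j → ∃ λ w → v ~ w × UnitStep (parityᵛ v) v w j
  unit-edge v j with parityᵛ v in eq
  unit-edge v 0F | 0ℙ = up-edge v
  unit-edge v 0F | 1ℙ = down-edge v
  unit-edge v 1F | 0ℙ = down-edge v
  unit-edge v 1F | 1ℙ = up-edge v
  unit-edge v 2F | 0ℙ = chord-up-edge v eq
  unit-edge v 2F | 1ℙ = chord-down-edge v eq

  private
    up-unit : ∀ {v w} g → Offset v w (+ 0) (+ 1) → ∃ (UnitStep g v w)
    up-unit 0ℙ o = 0F , o
    up-unit 1ℙ o = 1F , o

    down-unit : ∀ {v w} g → Offset v w (+ 0) (- + 1) → ∃ (UnitStep g v w)
    down-unit 0ℙ o = 1F , o
    down-unit 1ℙ o = 0F , o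

  edge-unit : ∀ {v w} → v ~ w → ∃ (UnitStep (parityᵛ v) v w)
  edge-unit {_ , i} (inj₁ (refl , inj₁ j≡i+1)) = up-unit (parity (toℕ i)) (offset stay (%⇒≡-mod (toℕ i) 1 j≡i+1))
  edge-unit {_ , i} {_ , j} (inj₁ (refl , inj₂ i≡j+1)) =
    down-unit (parity (toℕ i)) (offset stay (%⇒≡-mod⁻ (toℕ j) 1 i≡j+1))
  edge-unit {v@(α , i)} (inj₂ (inj₁ (2∣i , β≡α+1 , j≡i+c))) =
    subst (λ g → ∃ (UnitStep g v _)) (sym (2∣⇒parity≡0ℙ 2∣i))
          (2F , offset (%⇒≡-mod (toℕ α) 1 β≡α+1) (%⇒≡-mod (toℕ i) c j≡i+c))
  edge-unit {v} {β , j} (inj₂ (inj₂ (2∣j , α≡β+1 , i≡j+c))) =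
    subst (λ g → ∃ (UnitStep g v _)) (sym source-odd)
          (2F , offset (%⇒≡-mod⁻ (toℕ β) 1 α≡β+1) (%⇒≡-mod⁻ (toℕ j) c i≡j+c))
    where
    open ≡-Reasoning
    source-odd : parityᵛ v ≡ 1ℙ
    source-odd = begin
      parityᵛ v                            ≡⟨ cong parity i≡j+c ⟩
      parity ((toℕ j ℕ.+ c) ℕ.% N)         ≡⟨ parity-% (toℕ j ℕ.+ c) N 2∣N ⟩
      parity (toℕ j ℕ.+ c)                 ≡⟨ ℙₚ.+-homo-+ (toℕ j) c ⟩
      parity (toℕ j) ℙ.+ parity c          ≡⟨ cong₂ ℙ._+_ (2∣⇒parity≡0ℙ 2∣j) c-parity ⟩
      1ℙ                                   ∎

  ringShift posShift : Point → ℤ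
  ringShift (_ , _ , z) = z
  posShift  (x , y , z) = x - y + z * + c

  Lands : V → Point → V → Set
  Lands u p v = Offset u v (signed (parityᵛ u) (ringShift p)) (signed (parityᵛ u) (posShift p))

  lands-functional : ∀ {u v v′} p → Lands u p v → Lands u p v′ → v ≡ v′
  lands-functional _ = offset-functional

  private
    ringShift-⊕ : ∀ p q → ringShift (p ⊕ q) ≡ ringShift p + ringShift q
    ringShift-⊕ _ _ = refl

    ringShift-signed : ∀ s q → ringShift (signedᴾ s q) ≡ signed s (ringShift q)
    ringShift-signed _ _ = refl

    posShift-⊕ : ∀ p q → posShift (p ⊕ q) ≡ posShift p + posShift q
    posShift-⊕ (x , y , z) (x′ , y′ , z′) = linear x y z x′ y′ z′ (+ c)
      where
      linear : ∀ x y z x′ y′ z′ c → (x + x′) - (y + y′) + (z + z′) * c ≡ (x - y + z * c) + (x′ - y′ + z′ * c)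
      linear = solve-∀

    posShift-signed : ∀ s q → posShift (signedᴾ s q) ≡ signed s (posShift q)
    posShift-signed 0ℙ _ = refl
    posShift-signed 1ℙ (x , y , z) = negated x y z (+ c)
      where
      negated : ∀ x y z c → - x - - y + - z * c ≡ - (x - y + z * c)
      negated = solve-∀

    ringShift-unit : ∀ j → ringShift (unit j) ≡ ringUnit j
    ringShift-unit 0F = refl
    ringShift-unit 1F = refl
    ringShift-unit 2F = refl

    posShift-unit : ∀ j → posShift (unit j) ≡ posUnit j
    posShift-unit 0F = refl
    posShift-unit 1F = refl
    posShift-unit 2F = trans (ℤₚ.+-identityˡ (+ 1 * + c)) (ℤₚ.*-identityˡ (+ c))

  lands-extend : ∀ {u v w} p s j → Lands u p v → parityᵛ v ≡ parityᵛ u ℙ.+ s →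
                 UnitStep (parityᵛ v) v w j → Lands u (p ⊕ signedᴾ s (unit j)) w
  lands-extend {u} {v} {w} p s j lands parity-v unit-step = offset-cong
    (sym (trans (signed-shift ringShift ringShift-⊕ ringShift-signed g s p (unit j))
                (cong (λ t → signed g (ringShift p) + signed (g ℙ.+ s) t) (ringShift-unit j))))
    (sym (trans (signed-shift posShift posShift-⊕ posShift-signed g s p (unit j))
                (cong (λ t → signed g (posShift p) + signed (g ℙ.+ s) t) (posShift-unit j))))
    (offset-trans lands (subst (λ h → UnitStep h v w j) parity-v unit-step))
    where
    g : Parity
    g = parityᵛ u

  private
    c+1-even : 2 ∣ suc c
    c+1-even = parity≡0ℙ⇒2∣ (suc c) (trans (ℙₚ.+-homo-+ 1 c) (cong (1ℙ ℙ.+_) (∤2⇒parity≡1ℙ c-odd)))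

    posShift≡total : ∀ p → posShift p ≡ total p mod 2
    posShift≡total (x , y , z) with divides q c+1≡q*2 ← c+1-even =
      mod-intro (ℤ∣.divides (- y + z * (+ q - + 1)) (begin
        x - y + z * + c - (x + y + z)
          ≡⟨ expand x y z (+ c) (+ q) ⟩
        (- y + z * (+ q - + 1)) * + 2 + z * (+ 1 + + c - + q * + 2)
          ≡⟨ cong (λ t → (- y + z * (+ q - + 1)) * + 2 + z * t) vanishes ⟩
        (- y + z * (+ q - + 1)) * + 2 + z * + 0
          ≡⟨ cong (λ t → (- y + z * (+ q - + 1)) * + 2 + t) (ℤₚ.*-zeroʳ z) ⟩
        (- y + z * (+ q - + 1)) * + 2 + + 0
          ≡⟨ ℤₚ.+-identityʳ _ ⟩
        (- y + z * (+ q - + 1)) * + 2 ∎))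
      where
      open ≡-Reasoning
      expand : ∀ x y z c q → x - y + z * c - (x + y + z) ≡ (- y + z * (q - + 1)) * + 2 + z * (+ 1 + c - q * + 2)
      expand = solve-∀
      vanishes : + 1 + + c - + q * + 2 ≡ + 0
      vanishes = trans (cong (_- + q * + 2) (trans (cong +_ c+1≡q*2) (ℤₚ.pos-* q 2))) (ℤₚ.+-inverseʳ (+ q * + 2))

    signed≡-mod2 : ∀ g x → signed g x ≡ x mod 2
    signed≡-mod2 0ℙ x = mod-refl
    signed≡-mod2 1ℙ x = mod-intro (ℤ∣.divides (- x) (double x))
      where
      double : ∀ x → - x - x ≡ - x * + 2
      double = solve-∀

  lands-parity : ∀ {u v} p {s} → Lands u p v → total p ≡ + bit s → parityᵛ v ≡ parityᵛ u ℙ.+ s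
  lands-parity {u} p {s} (offset _ pos≡) total≡s = parity-≡-mod2 s
    (mod-trans (mod-∣ 2∣N pos≡) (mod-+ (mod-refl {pos u})
      (mod-trans (signed≡-mod2 (parityᵛ u) (posShift p)) (mod-trans (posShift≡total p) (≡⇒≡-mod total≡s)))))

  lands-step : ∀ {u v} p s → Lands u p v → total p ≡ + bit s →
               ∀ j → ∃ λ w → v ~ w × Lands u (p ⊕ signedᴾ s (unit j)) w
  lands-step {v = v} p s lands total≡s j with w , v~w , unit-step ← unit-edge v j =
    w , v~w , lands-extend p s j lands (lands-parity p lands total≡s) unit-step

  record Lift (u v : V) (d : ℕ) : Set where
    constructor lift
    field
      point       : Point
      totalParity : Parity
      lands       : Lands u point v
      total≡      : total point ≡ + bit totalParity
      inHex       : InHex d point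

  lift-origin : ∀ {u} → Lift u u 0
  lift-origin {u} = lift (+ 0 , + 0 , + 0) 0ℙ
    (offset-cong (sym (signed-0 (parityᵛ u))) (sym (signed-0 (parityᵛ u))) offset-refl) refl (z≤n , z≤n , z≤n)

  lift-step : ∀ {u v w d} → Lift u v d → v ~ w → Lift u w (suc d)
  lift-step (lift p s lands total≡s inHex) v~w with j , unit-step ← edge-unit v~w =
    lift (p ⊕ signedᴾ s (unit j)) (s ℙ.⁻¹)
         (lands-extend p s j lands (lands-parity p lands total≡s) unit-step)
         (total-step p s j total≡s)
         (inHex-step p s j inHex)

  lift-weaken : ∀ {u v d d′} → d ≤ d′ → Lift u v d → Lift u v d′
  lift-weaken d≤d′ (lift p s lands total≡s inHex) = lift p s lands total≡s (inHex-weaken p d≤d′ inHex)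

  walk-lift : ∀ {u v d} → Within M N c d u v → Lift u v d
  walk-lift {u} {v} {d} walk = subst (Lift u v) (ℕₚ.+-identityʳ d) (extend walk lift-origin)
    where
    extend : ∀ {v w d b} → Within M N c d v w → Lift u v b → Lift u w (d ℕ.+ b)
    extend {d = d} {b} here l = lift-weaken (ℕₚ.m≤n+m b d) l
    extend {d = suc d} {b} (step v~v′ walk) l =
      subst (Lift u _) (ℕₚ.+-suc d b) (extend walk (lift-step l v~v′))

module OppositeClass (m₀ n₀ c : ℕ) (2∣N : 2 ∣ suc n₀) (c-odd : ¬ 2 ∣ c)
                     (u : Vertex (suc m₀) (suc n₀)) (r : ℕ)
                     (reach : ∀ v → Within (suc m₀) (suc n₀) c (r ℕ.+ r) u v) where
  open CMR m₀ n₀ c 2∣N c-odd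

  Opposite : V → Set
  Opposite v = parityᵛ v ≡ parityᵛ u ℙ.+ 1ℙ

  private
    land-in-hexagon : ∀ {v} p → Lands u p v → total p ≡ + 1 → InHex (r ℕ.+ r) p →
                      Σ (HexIndex r) λ h → Lands u (hexAt h) v
    land-in-hexagon {v} p lands total≡1 inHex =
      let (h , p≡h) = hex-classification r p total≡1 inHex in h , subst (λ q → Lands u q v) p≡h lands

  hexOf : ∀ v → Opposite v → Σ (HexIndex r) λ h → Lands u (hexAt h) v
  hexOf v opposite = land-in-hexagon point lands (trans total≡ (cong (λ s → + bit s) odd)) inHex
    where
    open Lift (walk-lift (reach v))
    odd : totalParity ≡ 1ℙ
    odd = ℙₚ.+-cancelˡ-≡ (parityᵛ u) totalParity 1ℙ (trans (sym (lands-parity point lands total≡)) opposite)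

  hexOf-injective : ∀ {v w} (ov : Opposite v) (ow : Opposite w) → proj₁ (hexOf v ov) ≡ proj₁ (hexOf w ow) → v ≡ w
  hexOf-injective {v} {w} ov ow same = lands-functional (hexAt (proj₁ (hexOf v ov))) (proj₂ (hexOf v ov))
    (subst (λ h → Lands u (hexAt h) w) (sym same) (proj₂ (hexOf w ow)))

module OrderBound (m₀ n₀ c : ℕ) (2∣N : 2 ∣ suc n₀) (c-odd : ¬ 2 ∣ c) where
  open CMR m₀ n₀ c 2∣N c-odd

  h : ℕ
  h = quotient 2∣N

  N≡h*2 : N ≡ h ℕ.* 2
  N≡h*2 = m∣n⇒n≡quotient*m 2∣N

  origin : V
  origin = Fin.zero , Fin.zero

  private
    odd<N : (k : Fin h) → suc (toℕ k ℕ.* 2) < N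
    odd<N k = subst (suc (toℕ k ℕ.* 2) <_) (sym N≡h*2) (ℕₚ.*-monoˡ-≤ 2 (Finₚ.toℕ<n k))

  oddVertex : Fin M × Fin h → V
  oddVertex (α , k) = α , fromℕ< (odd<N k)

  oddVertex-odd : ∀ x → parityᵛ (oddVertex x) ≡ 1ℙ
  oddVertex-odd (_ , k) = begin
    parity (toℕ (fromℕ< (odd<N k)))      ≡⟨ cong parity (Finₚ.toℕ-fromℕ< (odd<N k)) ⟩
    parity (1 ℕ.+ toℕ k ℕ.* 2)           ≡⟨ ℙₚ.+-homo-+ 1 (toℕ k ℕ.* 2) ⟩
    1ℙ ℙ.+ parity (toℕ k ℕ.* 2)          ≡⟨ cong (1ℙ ℙ.+_) (2∣⇒parity≡0ℙ (divides (toℕ k) refl)) ⟩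
    1ℙ                                   ∎
    where open ≡-Reasoning

  oddVertex-injective : Injective _≡_ _≡_ oddVertex
  oddVertex-injective {α , k} {α′ , k′} e = cong₂ _,_ (,-injectiveˡ e)
    (Finₚ.toℕ-injective (ℕₚ.*-cancelʳ-≡ (toℕ k) (toℕ k′) 2 (ℕₚ.suc-injective
      (trans (sym (Finₚ.toℕ-fromℕ< (odd<N k))) (trans (cong toℕ (,-injectiveʳ e)) (Finₚ.toℕ-fromℕ< (odd<N k′)))))))

  order-bound : ∀ r → (∀ v → Within M N c (r ℕ.+ r) origin v) → M ℕ.* h ≤ 3 ℕ.* (r ℕ.* r)
  order-bound r reach = Finₚ.injective⇒≤ {f = code} code-injective
    where
    open OppositeClass m₀ n₀ c 2∣N c-odd origin r reach
    vertexOf : Fin (M ℕ.* h) → V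
    vertexOf i = oddVertex (Fin.remQuot {M} h i)
    code : Fin (M ℕ.* h) → Fin (3 ℕ.* (r ℕ.* r))
    code i = encodeHex (proj₁ (hexOf (vertexOf i) (oddVertex-odd (Fin.remQuot {M} h i))))
    code-injective : Injective _≡_ _≡_ code
    code-injective {i} {j} e = begin
      i                                  ≡⟨ Finₚ.combine-remQuot {M} h i ⟨
      uncurry Fin.combine (Fin.remQuot {M} h i)  ≡⟨ cong (uncurry Fin.combine) (oddVertex-injective
        (hexOf-injective {vertexOf i} {vertexOf j} (oddVertex-odd (Fin.remQuot {M} h i)) (oddVertex-odd (Fin.remQuot {M} h j))
          (encodeHex-injective e))) ⟩
      uncurry Fin.combine (Fin.remQuot {M} h j)  ≡⟨ Finₚ.combine-remQuot {M} h j ⟩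
      j                                  ∎
      where open ≡-Reasoning

module Extremal (r₀ : ℕ) where
  open import Data.Integer using (_+_; _-_; _*_; -_)

  r n₀ : ℕ
  r  = suc r₀
  -- suc n₀ reduces to 3 * (r * 2), so the graph below is CMR(r, 6r, 3) as in the theorem.
  n₀ = ℕ.pred (3 ℕ.* (r ℕ.* 2))

  N≡3r*2 : suc n₀ ≡ 3 ℕ.* r ℕ.* 2
  N≡3r*2 = sym (ℕₚ.*-assoc 3 r 2)

  N≡r*6 : suc n₀ ≡ r ℕ.* 6
  N≡r*6 = reassociate r
    where
    reassociate : ∀ r → 3 ℕ.* (r ℕ.* 2) ≡ r ℕ.* 6
    reassociate = solve-ℕ

  3-odd : ¬ 2 ∣ 3
  3-odd 2∣3 with () ← 2∣⇒parity≡0ℙ 2∣3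

  open CMR r₀ n₀ 3 (divides (3 ℕ.* r) N≡3r*2) 3-odd

  Close : Point → Point → Set
  Close (a , b , c) (a′ , b′ , c′) = ∣ a - a′ ∣ < r ℕ.+ r × ∣ b - b′ ∣ < r ℕ.+ r × ∣ c - c′ ∣ < r ℕ.+ r

  private
    r<r+r : r < r ℕ.+ r
    r<r+r = ℕₚ.m<m+n r (s≤s z≤n)

    r+r<r*3 : r ℕ.+ r < r ℕ.* 3
    r+r<r*3 = subst (r ℕ.+ r <_) (regroup r) (ℕₚ.m<m+n (r ℕ.+ r) (s≤s z≤n))
      where
      regroup : ∀ r → r ℕ.+ r ℕ.+ r ≡ r ℕ.* 3
      regroup = solve-ℕ

    twice-vanishing : ∀ w → + N ℤ∣.∣ w * + 2 → ∣ w ∣ < r ℕ.* 3 → w ≡ + 0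
    twice-vanishing w N∣2w small = ℤₚ.*-cancelʳ-≡ w (+ 0) (+ 2) (∣∧<⇒≡0 N∣2w (begin-strict
      ∣ w * + 2 ∣        ≡⟨ ℤₚ.abs-* w (+ 2) ⟩
      ∣ w ∣ ℕ.* 2        <⟨ ℕₚ.*-monoˡ-< 2 small ⟩
      r ℕ.* 3 ℕ.* 2      ≡⟨ regroup r ⟩
      N                  ∎))
      where
      open ℕₚ.≤-Reasoning
      regroup : ∀ r → r ℕ.* 3 ℕ.* 2 ≡ 3 ℕ.* (r ℕ.* 2)
      regroup = solve-ℕ

    small-multiple-of-r : ∀ C → + r ℤ∣.∣ C → ∣ C ∣ < r ℕ.+ r → C ≡ + 0 ⊎ C ≡ + r ⊎ C ≡ - + r
    small-multiple-of-r C r∣C small with ℤ∣.∣⇒∣ᵤ r∣C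
    ... | divides zero          eq = inj₁ (ℤₚ.∣i∣≡0⇒i≡0 eq)
    ... | divides (suc zero)    eq = inj₂ (signs C (trans eq (ℕₚ.+-identityʳ r)))
      where
      signs : ∀ C → ∣ C ∣ ≡ r → C ≡ + r ⊎ C ≡ - + r
      signs (+ _)      refl = inj₁ refl
      signs -[1+ _ ]   refl = inj₂ refl
    ... | divides (suc (suc q)) eq =
      contradiction (subst (r ℕ.+ r ≤_) (sym eq) (ℕₚ.+-monoʳ-≤ r (ℕₚ.m≤m+n r (q ℕ.* r)))) (ℕₚ.<⇒≱ small)

    ∣-C-C∣≡r+r : ∀ C → C ≡ + r ⊎ C ≡ - + r → ∣ - C - C ∣ ≡ r ℕ.+ r
    ∣-C-C∣≡r+r _ (inj₁ refl) = cong suc (sym (ℕₚ.+-suc r₀ r₀))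
    ∣-C-C∣≡r+r _ (inj₂ refl) = refl

    N∣C*6 : ∀ C → C ≡ + r ⊎ C ≡ - + r → + N ℤ∣.∣ C * + 6
    N∣C*6 _ (inj₁ refl) = ℤ∣.∣-reflexive (trans (cong +_ N≡r*6) (ℤₚ.pos-* r 6))
    N∣C*6 _ (inj₂ refl) =
      subst (+ N ℤ∣.∣_) (ℤₚ.neg-distribˡ-* (+ r) (+ 6)) (ℤ∣.∣m⇒∣-m (N∣C*6 (+ r) (inj₁ refl)))

    ∣C∣≡r : ∀ C → C ≡ + r ⊎ C ≡ - + r → ∣ C ∣ ≡ r
    ∣C∣≡r _ (inj₁ refl) = refl
    ∣C∣≡r _ (inj₂ refl) = refl

  -- C is 0 or ±r; with B = −A − C, 6r divides 2A + 4C, which for C = ±r forces A = C and |B| = 2r.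
  hex-rigid : ∀ A B C → A + B + C ≡ + 0 → ∣ A ∣ < r ℕ.+ r → ∣ B ∣ < r ℕ.+ r → ∣ C ∣ < r ℕ.+ r →
              + r ℤ∣.∣ C → + N ℤ∣.∣ A - B + C * + 3 → A ≡ + 0 × B ≡ + 0 × C ≡ + 0
  hex-rigid A B C sum≡0 ∣A∣< ∣B∣< ∣C∣< r∣C N∣shift = by-cases (small-multiple-of-r C r∣C ∣C∣<)
    where
    B≡-A-C : B ≡ - A - C
    B≡-A-C = trans (isolate A B C) (trans (cong (λ s → s - A - C) sum≡0) (drop A C))
      where
      isolate : ∀ A B C → B ≡ A + B + C - A - C
      isolate = solve-∀
      drop : ∀ A C → + 0 - A - C ≡ - A - C
      drop = solve-∀

    shape : ∀ A C → A - (- A - C) + C * + 3 ≡ A * + 2 + C * + 4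
    shape = solve-∀

    N∣A*2+C*4 : + N ℤ∣.∣ A * + 2 + C * + 4
    N∣A*2+C*4 = subst (+ N ℤ∣.∣_) (trans (cong (λ b → A - b + C * + 3) B≡-A-C) (shape A C)) N∣shift

    by-cases : C ≡ + 0 ⊎ C ≡ + r ⊎ C ≡ - + r → A ≡ + 0 × B ≡ + 0 × C ≡ + 0
    by-cases (inj₁ refl) = A≡0 , trans B≡-A-C (cong (λ a → - a - + 0) A≡0) , refl
      where
      A≡0 : A ≡ + 0
      A≡0 = twice-vanishing A (subst (+ N ℤ∣.∣_) (ℤₚ.+-identityʳ (A * + 2)) N∣A*2+C*4)
                              (ℕₚ.<-trans ∣A∣< r+r<r*3)
    by-cases (inj₂ ±r) =
      ⊥-elim (ℕₚ.<-irrefl (∣-C-C∣≡r+r C ±r)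
        (subst (λ b → ∣ b ∣ < r ℕ.+ r) (trans B≡-A-C (cong (λ a → - a - C) A≡C)) ∣B∣<))
      where
      recentre : ∀ A C → A * + 2 + C * + 4 - C * + 6 ≡ (A - C) * + 2
      recentre = solve-∀
      regroup : ∀ r → r ℕ.+ r ℕ.+ r ≡ r ℕ.* 3
      regroup = solve-ℕ
      A≡C : A ≡ C
      A≡C = ℤₚ.i-j≡0⇒i≡j A C (twice-vanishing (A - C)
        (subst (+ N ℤ∣.∣_) (recentre A C) (ℤ∣.∣m∣n⇒∣m-n N∣A*2+C*4 (N∣C*6 C ±r)))
        (ℕₚ.≤-<-trans (ℤₚ.∣i-j∣≤∣i∣+∣j∣ A C) (subst (λ c → ∣ A ∣ ℕ.+ c < r ℕ.* 3) (sym (∣C∣≡r C ±r))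
          (subst (∣ A ∣ ℕ.+ r <_) (regroup r) (ℕₚ.+-monoˡ-< r ∣A∣<)))))

  private
    unsign : ∀ g {x y n} → signed g x ≡ signed g y mod n → x ≡ y mod n
    unsign 0ℙ x≡y = x≡y
    unsign 1ℙ {x} {y} (mod-intro n∣-x+y) = mod-intro (subst (_ ℤ∣.∣_) (flip x y) (ℤ∣.∣m⇒∣-m n∣-x+y))
      where
      flip : ∀ x y → - (- x - - y) ≡ x - y
      flip = solve-∀

  lands-rigid : ∀ {u v} p q → Lands u p v → Lands u q v → total p ≡ total q → Close p q → p ≡ q
  lands-rigid {u} p@(a , b , c) q@(a′ , b′ , c′) lands-p lands-q same-total (close-a , close-b , close-c) =
    cong₂ _,_ (ℤₚ.i-j≡0⇒i≡j a a′ (proj₁ rigid))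
              (cong₂ _,_ (ℤₚ.i-j≡0⇒i≡j b b′ (proj₁ (proj₂ rigid))) (ℤₚ.i-j≡0⇒i≡j c c′ (proj₂ (proj₂ rigid))))
    where
    ring≡ : c ≡ c′ mod r
    ring≡ = unsign (parityᵛ u) (proj₁ (offset-difference lands-p lands-q))
    pos≡ : posShift p ≡ posShift q mod N
    pos≡ = unsign (parityᵛ u) (proj₂ (offset-difference lands-p lands-q))
    difference-total : ∀ a b c a′ b′ c′ → (a - a′) + (b - b′) + (c - c′) ≡ (a + b + c) - (a′ + b′ + c′)
    difference-total = solve-∀
    difference-shift : ∀ a b c a′ b′ c′ →
                       (a - b + c * + 3) - (a′ - b′ + c′ * + 3) ≡ (a - a′) - (b - b′) + (c - c′) * + 3
    difference-shift = solve-∀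
    rigid : a - a′ ≡ + 0 × b - b′ ≡ + 0 × c - c′ ≡ + 0
    rigid = hex-rigid (a - a′) (b - b′) (c - c′)
      (trans (difference-total a b c a′ b′ c′) (trans (cong (_- total q) same-total) (ℤₚ.+-inverseʳ (total q))))
      close-a close-b close-c (_≡_mod_.∣-difference ring≡)
      (subst (+ N ℤ∣.∣_) (difference-shift a b c a′ b′ c′) (_≡_mod_.∣-difference pos≡))

  private
    record InBox (z : ℤ) : Set where
      constructor box
      field
        height   : ℕ
        height<  : height < r ℕ.+ r
        z+r₀≡    : z + + r₀ ≡ + height

    boxes-close : ∀ {z z′} → InBox z → InBox z′ → ∣ z - z′ ∣ < r ℕ.+ r
    boxes-close {z} {z′} (box n n< z≡) (box n′ n′< z′≡) =
      subst (_< r ℕ.+ r) (cong ∣_∣ (trans (cong₂ _-_ (sym z≡) (sym z′≡)) (cancel z z′ (+ r₀)))) (∣m-n∣<k n< n′<)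
      where
      cancel : ∀ z z′ R → (z + R) - (z′ + R) ≡ z - z′
      cancel = solve-∀

    r₀<r+r : r₀ < r ℕ.+ r
    r₀<r+r = ℕₚ.<-trans (ℕₚ.n<1+n r₀) r<r+r

    box-positive : ∀ {x} → x < r → InBox (+ suc x)
    box-positive x<r = box _ (ℕₚ.+-mono-≤-< x<r (ℕₚ.n<1+n r₀)) refl

    box-nonpositive : ∀ {y} → y < r → InBox (- + y)
    box-nonpositive {y} (s≤s y≤r₀) = box (r₀ ℕ.∸ y) (ℕₚ.≤-<-trans (ℕₚ.m∸n≤m r₀ y) r₀<r+r)
      (trans (ℤₚ.+-comm (- + y) (+ r₀)) (trans (ℤₚ.m-n≡m⊖n r₀ y) (ℤₚ.⊖-≥ y≤r₀)))

    box-middle : ∀ {x y} → x < r → y < r → InBox (+ y - + x)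
    box-middle {x} {y} (s≤s x≤r₀) y<r = box (y ℕ.+ r₀ ℕ.∸ x)
      (ℕₚ.≤-<-trans (ℕₚ.m∸n≤m (y ℕ.+ r₀) x) (ℕₚ.+-mono-<-≤ y<r (ℕₚ.n≤1+n r₀)))
      (trans (regroup (+ y) (+ x) (+ r₀))
             (trans (ℤₚ.m-n≡m⊖n (y ℕ.+ r₀) x) (ℤₚ.⊖-≥ (ℕₚ.≤-trans x≤r₀ (ℕₚ.m≤n+m r₀ y)))))
      where
      regroup : ∀ y x r → y - x + r ≡ (y + r) - x
      regroup = solve-∀

    hexPoint-boxes : ∀ t {x y} → x < r → y < r → let (a , b , c) = hexPoint t x y in InBox a × InBox b × InBox c
    hexPoint-boxes 0F x<r y<r = box-positive x<r , box-nonpositive y<r , box-middle x<r y<r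
    hexPoint-boxes 1F x<r y<r = box-middle x<r y<r , box-positive x<r , box-nonpositive y<r
    hexPoint-boxes 2F x<r y<r = box-nonpositive y<r , box-middle x<r y<r , box-positive x<r

    hexAt-boxes : (h : HexIndex r) → let (a , b , c) = hexAt h in InBox a × InBox b × InBox c
    hexAt-boxes (t , x , y) = hexPoint-boxes t (Finₚ.toℕ<n x) (Finₚ.toℕ<n y)

  hexAt-close : ∀ h h′ → Close (hexAt h) (hexAt h′)
  hexAt-close h h′ with hexAt-boxes h | hexAt-boxes h′
  ... | ba , bb , bc | ba′ , bb′ , bc′ = boxes-close ba ba′ , boxes-close bb bb′ , boxes-close bc bc′

  record Realized (u : V) (p : Point) (d : ℕ) : Set where
    constructor realized
    field
      endpoint : V
      walk     : Within M N 3 d u endpoint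
      lands    : Lands u p endpoint

  pair-step : ∀ {u d} p j⁻ j⁺ → total p ≡ + 1 → Realized u p d → Realized u (pairMove j⁻ j⁺ p) (suc (suc d))
  pair-step {u} p j⁻ j⁺ total≡1 (realized v walk lands) =
    realized (proj₁ second) (within-snoc (within-snoc walk (proj₁ (proj₂ first))) (proj₁ (proj₂ second)))
             (proj₂ (proj₂ second))
    where
    first : ∃ λ v′ → v ~ v′ × Lands u (p ⊕ signedᴾ 1ℙ (unit j⁻)) v′
    first = lands-step p 1ℙ lands total≡1 j⁻
    second : ∃ λ w → proj₁ first ~ w × Lands u (pairMove j⁻ j⁺ p) w
    second = lands-step (p ⊕ signedᴾ 1ℙ (unit j⁻)) 0ℙ (proj₂ (proj₂ first)) (total-step p 1ℙ j⁻ total≡1) j⁺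

  private
    grow : ∀ {u d} p {q} j⁻ j⁺ → total p ≡ + 1 → q ≡ pairMove j⁻ j⁺ p →
           Realized u p (suc (d ℕ.+ d)) → Realized u q (suc (suc d ℕ.+ suc d))
    grow {u} {d} p j⁻ j⁺ total≡1 refl prefix =
      subst (Realized u (pairMove j⁻ j⁺ p)) (cong (suc ∘ suc) (sym (ℕₚ.+-suc d d))) (pair-step p j⁻ j⁺ total≡1 prefix)

  realize : ∀ u t d x y → x ≤ d → y ≤ d → Realized u (hexPoint t x y) (suc (d ℕ.+ d))
  realize u t d zero zero _ _ =
    realized (proj₁ first) (within-weaken (s≤s z≤n) (step (proj₁ (proj₂ first)) here))
             (subst (λ p → Lands u p (proj₁ first)) (start t) (proj₂ (proj₂ first)))
    where
    first : ∃ λ w → u ~ w × Lands u ((+ 0 , + 0 , + 0) ⊕ signedᴾ 0ℙ (unit t)) w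
    first = lands-step (+ 0 , + 0 , + 0) 0ℙ (Lift.lands (lift-origin {u})) refl t
    start : ∀ t → (+ 0 , + 0 , + 0) ⊕ signedᴾ 0ℙ (unit t) ≡ hexPoint t 0 0
    start 0F = refl
    start 1F = refl
    start 2F = refl
  realize u t (suc d) (suc x) (suc y) (s≤s x≤d) (s≤s y≤d) =
    grow (hexPoint t x y) (next t) t (hexPoint-total t x y) (grow-both t x y) (realize u t d x y x≤d y≤d)
  realize u t (suc d) (suc x) zero (s≤s x≤d) _ =
    grow (hexPoint t x 0) (next (next t)) t (hexPoint-total t x 0) (grow-first t x) (realize u t d x 0 x≤d z≤n)
  realize u t (suc d) zero (suc y) _ (s≤s y≤d) =
    grow (hexPoint t 0 y) (next t) (next (next t)) (hexPoint-total t 0 y) (grow-second t y) (realize u t d 0 y z≤n y≤d)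


  hexWalk : ∀ u (h : HexIndex r) → Realized u (hexAt h) (suc (r₀ ℕ.+ r₀))
  hexWalk u (t , x , y) = realize u t r₀ (toℕ x) (toℕ y) (ℕ.s≤s⁻¹ (Finₚ.toℕ<n x)) (ℕ.s≤s⁻¹ (Finₚ.toℕ<n y))

  hexWalk-injective : ∀ u {h h′} → Realized.endpoint (hexWalk u h) ≡ Realized.endpoint (hexWalk u h′) → h ≡ h′
  hexWalk-injective u {h} {h′} same = hexAt-injective (lands-rigid (hexAt h) (hexAt h′)
    (Realized.lands (hexWalk u h)) (subst (Lands u (hexAt h′)) (sym same) (Realized.lands (hexWalk u h′)))
    (trans (hexAt-total h) (sym (hexAt-total h′))) (hexAt-close h h′))

  private
    half< : (i : Fin N) → toℕ i ℕ./ 2 < 3 ℕ.* r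
    half< i = m<n*o⇒m/o<n (subst (toℕ i <_) N≡3r*2 (Finₚ.toℕ<n i))

  classIndex : V → HexIndex r
  classIndex (α , i) = let (t , x) = Fin.remQuot {3} r (fromℕ< (half< i)) in t , α , x

  classIndex-injective : ∀ {v w} → parityᵛ v ≡ parityᵛ w → classIndex v ≡ classIndex w → v ≡ w
  classIndex-injective {α , i} {α′ , i′} same-parity same-index =
    cong₂ _,_ (,-injectiveˡ (,-injectiveʳ same-index)) (Finₚ.toℕ-injective (half-injective same-parity same-half))
    where
    open ≡-Reasoning
    same-split : Fin.remQuot {3} r (fromℕ< (half< i)) ≡ Fin.remQuot {3} r (fromℕ< (half< i′))
    same-split = cong₂ _,_ (,-injectiveˡ same-index) (,-injectiveʳ (,-injectiveʳ same-index))
    same-half : toℕ i ℕ./ 2 ≡ toℕ i′ ℕ./ 2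
    same-half = begin
      toℕ i ℕ./ 2                                                 ≡⟨ Finₚ.toℕ-fromℕ< (half< i) ⟨
      toℕ (fromℕ< (half< i))                                      ≡⟨ cong toℕ (Finₚ.combine-remQuot {3} r _) ⟨
      toℕ (uncurry Fin.combine (Fin.remQuot {3} r (fromℕ< (half< i))))   ≡⟨ cong (toℕ ∘ uncurry Fin.combine) same-split ⟩
      toℕ (uncurry Fin.combine (Fin.remQuot {3} r (fromℕ< (half< i′))))  ≡⟨ cong toℕ (Finₚ.combine-remQuot {3} r _) ⟩
      toℕ (fromℕ< (half< i′))                                     ≡⟨ Finₚ.toℕ-fromℕ< (half< i′) ⟩
      toℕ i′ ℕ./ 2                                                ∎

  opposite-reachable : ∀ u v → parityᵛ v ≡ parityᵛ u ℙ.+ 1ℙ → Within M N 3 (suc (r₀ ℕ.+ r₀)) u v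
  opposite-reachable u v opposite =
    subst (Within M N 3 _ u) (proj₂ covered) (Realized.walk (hexWalk u (decodeHex {r} (proj₁ covered))))
    where
    Opposite : V → Set
    Opposite w = parityᵛ w ≡ parityᵛ u ℙ.+ 1ℙ
    target : Fin (3 ℕ.* (r ℕ.* r)) → V
    target i = Realized.endpoint (hexWalk u (decodeHex {r} i))
    covered : ∃ λ i → target i ≡ v
    covered = injections-onto Opposite target (encodeHex {r} ∘ classIndex)
      (λ i → lands-parity (hexAt (decodeHex {r} i)) (Realized.lands (hexWalk u (decodeHex {r} i))) (hexAt-total (decodeHex {r} i)))
      (λ same → decodeHex-injective {r} (hexWalk-injective u same))
      (λ ov ow same → classIndex-injective (trans ov (sym ow)) (encodeHex-injective same))
      v opposite

  private
    parity-cases : ∀ p q → p ≡ q ℙ.+ 1ℙ ⊎ p ≡ q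
    parity-cases 0ℙ 0ℙ = inj₂ refl
    parity-cases 0ℙ 1ℙ = inj₁ refl
    parity-cases 1ℙ 0ℙ = inj₁ refl
    parity-cases 1ℙ 1ℙ = inj₂ refl

    up-flips-parity : ∀ {v w} → Offset v w (+ 0) (+ 1) → parityᵛ w ≡ parityᵛ v ℙ.+ 1ℙ
    up-flips-parity (offset _ pos≡) = parity-≡-mod2 1ℙ (mod-∣ (divides (3 ℕ.* r) N≡3r*2) pos≡)

  diameter-upper : ∀ u v → Within M N 3 (r ℕ.+ r) u v
  diameter-upper u v with parity-cases (parityᵛ v) (parityᵛ u)
  ... | inj₁ opposite = within-weaken (s≤s (ℕₚ.+-monoʳ-≤ r₀ (ℕₚ.n≤1+n r₀))) (opposite-reachable u v opposite)
  ... | inj₂ same =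
    let (w , v~w , up) = up-edge v in
    subst (λ n → Within M N 3 n u v) (cong suc (sym (ℕₚ.+-suc r₀ r₀)))
      (within-snoc (opposite-reachable u w (trans (up-flips-parity up) (cong (ℙ._+ 1ℙ) same))) (~-sym v~w))

  private
    r+r<N : r ℕ.+ r < N
    r+r<N = subst (r ℕ.+ r <_) (sym N≡r*6)
      (subst (_< r ℕ.* 6) (sym (m+m≡m*2 r)) (ℕₚ.*-monoʳ-< r (s≤s (s≤s (s≤s z≤n)))))

  origin antipode : V
  origin   = Fin.zero , Fin.zero
  antipode = Fin.zero , fromℕ< r+r<N

  private
    antipode-even : parityᵛ antipode ≡ 0ℙ
    antipode-even = trans (cong parity (Finₚ.toℕ-fromℕ< r+r<N)) (2∣⇒parity≡0ℙ (divides r (m+m≡m*2 r)))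

    -- 2r steps up the cycle.
    reference : Point
    reference = (+ r , - + r , + 0)

    lands-reference : Lands origin reference antipode
    lands-reference =
      offset mod-refl (≡⇒≡-mod (cong +_ (trans (Finₚ.toℕ-fromℕ< r+r<N) (sym (ℕₚ.+-identityʳ (r ℕ.+ r))))))

    reference-total : total reference ≡ + 0
    reference-total = trans (ℤₚ.+-identityʳ (+ r - + r)) (ℤₚ.+-inverseʳ (+ r))

    short-coordinate : ∀ {d} z e → e ≡ z * + 2 → ∣ e ∣ ≤ d → d < r ℕ.+ r → ∣ z ∣ < r
    short-coordinate {d} z e e≡2z ∣e∣≤d d<r+r = ℕₚ.*-cancelʳ-< 2 ∣ z ∣ r (begin-strict
      ∣ z ∣ ℕ.* 2   ≡⟨ ℤₚ.abs-* z (+ 2) ⟨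
      ∣ z * + 2 ∣   ≡⟨ cong ∣_∣ e≡2z ⟨
      ∣ e ∣         ≤⟨ ∣e∣≤d ⟩
      d             <⟨ d<r+r ⟩
      r ℕ.+ r       ≡⟨ m+m≡m*2 r ⟩
      r ℕ.* 2       ∎)
      where open ℕₚ.≤-Reasoning

    near : ∀ z w → ∣ z ∣ < r → ∣ w ∣ ≤ r → ∣ z - w ∣ < r ℕ.+ r
    near z w ∣z∣<r ∣w∣≤r = ℕₚ.≤-<-trans (ℤₚ.∣i-j∣≤∣i∣+∣j∣ z w) (ℕₚ.+-mono-<-≤ ∣z∣<r ∣w∣≤r)

    antipode-far : ∀ {d} p → Lands origin p antipode → total p ≡ + 0 → InHex d p → ¬ d < r ℕ.+ r
    antipode-far (a , b , c) lands-p sum≡0 (ha , hb , hc) d<r+r =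
      ℕₚ.<-irrefl (cong ∣_∣ (,-injectiveˡ p≡reference)) ∣a∣<r
      where
      collapse : ∀ x {e} → e ≡ x * + 2 - (a + b + c) → e ≡ x * + 2
      collapse x e≡ = trans e≡ (trans (cong (λ s → x * + 2 - s) sum≡0) (ℤₚ.+-identityʳ (x * + 2)))
      first : ∀ a b c → a - b - c ≡ a * + 2 - (a + b + c)
      first = solve-∀
      second : ∀ a b c → b - a - c ≡ b * + 2 - (a + b + c)
      second = solve-∀
      third : ∀ a b c → c - a - b ≡ c * + 2 - (a + b + c)
      third = solve-∀
      ∣a∣<r : ∣ a ∣ < r
      ∣a∣<r = short-coordinate a (a - b - c) (collapse a (first a b c)) ha d<r+r
      ∣b∣<r : ∣ b ∣ < r
      ∣b∣<r = short-coordinate b (b - a - c) (collapse b (second a b c)) hb d<r+r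
      ∣c∣<r : ∣ c ∣ < r
      ∣c∣<r = short-coordinate c (c - a - b) (collapse c (third a b c)) hc d<r+r
      p≡reference : (a , b , c) ≡ reference
      p≡reference = lands-rigid (a , b , c) reference lands-p lands-reference (trans sum≡0 (sym reference-total))
        (near a (+ r) ∣a∣<r ℕₚ.≤-refl , near b (- + r) ∣b∣<r ℕₚ.≤-refl , near c (+ 0) ∣c∣<r z≤n)

  diameter-lower : ∀ {d} → Within M N 3 d origin antipode → r ℕ.+ r ≤ d
  diameter-lower walk = ℕₚ.≮⇒≥ (antipode-far point lands (trans total≡ (cong (λ s → + bit s) even)) inHex)
    where
    open Lift (walk-lift walk)
    even : totalParity ≡ 0ℙ
    even = trans (sym (lands-parity point lands total≡)) antipode-even

open import Data.Nat using (_+_; _*_)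

extremal-diameter : ∀ r₀ → HasDiameter (suc r₀) (3 * (suc r₀ * 2)) 3 (suc r₀ * 2)
extremal-diameter r₀ =
  (λ u v → subst (λ d → Within _ _ 3 d u v) (m+m≡m*2 (suc r₀)) (diameter-upper u v)) ,
  (λ d all → subst (_≤ d) (m+m≡m*2 (suc r₀)) (diameter-lower (all origin antipode)))
  where
  open Extremal r₀ using (diameter-upper; diameter-lower; origin; antipode)

order-bound-for-diameter : ∀ r m n c → 1 ≤ m → 1 ≤ n → 2 ∣ n → ¬ 2 ∣ c →
                           HasDiameter m n c (r * 2) → m * n ≤ r * (3 * (r * 2))
order-bound-for-diameter r (suc m₀) (suc n₀) c _ _ 2∣n@(divides h n≡h*2) c-odd (all-within , _) = begin
  suc m₀ * suc n₀        ≡⟨ cong (suc m₀ *_) n≡h*2 ⟩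
  suc m₀ * (h * 2)       ≡⟨ ℕₚ.*-assoc (suc m₀) h 2 ⟨
  suc m₀ * h * 2         ≤⟨ ℕₚ.*-monoˡ-≤ 2 (order-bound r within-r+r) ⟩
  3 * (r * r) * 2        ≡⟨ regroup r ⟩
  r * (3 * (r * 2))      ∎
  where
  open ℕₚ.≤-Reasoning
  open OrderBound m₀ n₀ c 2∣n c-odd using (order-bound; origin)
  within-r+r : ∀ v → Within (suc m₀) (suc n₀) c (r + r) origin v
  within-r+r v = subst (λ d → Within _ _ c d origin v) (sym (m+m≡m*2 r)) (all-within origin v)
  regroup : ∀ r → 3 * (r * r) * 2 ≡ r * (3 * (r * 2))
  regroup = solve-ℕ

r*2/2≡r : ∀ r → r * 2 / 2 ≡ r
r*2/2≡r r = m*n/n≡m r 2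

mainTheorem3 : (k : ℕ) → 2 ≤ k → 2 ∣ k →
    HasDiameter (k / 2) (3 * k) 3 k
    × 2 * ((k / 2) * (3 * k)) ≡ 3 * (k * k)
    × ((m n c : ℕ) → 1 ≤ m → 1 ≤ n → 2 ∣ n → 1 < c → ¬ (2 ∣ c) →
       HasDiameter m n c k → m * n ≤ (k / 2) * (3 * k))
mainTheorem3 _ (s≤s (s≤s _)) (divides zero ())
mainTheorem3 _ _ (divides (suc r₀) refl) rewrite r*2/2≡r (suc r₀) =
  extremal-diameter r₀ , twice-order (suc r₀) ,
  λ m n c m≥1 n≥1 2∣n _ c-odd → order-bound-for-diameter (suc r₀) m n c m≥1 n≥1 2∣n c-odd
  where
  twice-order : ∀ r → 2 * (r * (3 * (r * 2))) ≡ 3 * (r * 2 * (r * 2))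
  twice-order = solve-ℕ
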